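{- Let $G$ be an arbitrary connected graph with independence number $\alpha(G)=\alpha\ge 2$, and let $H$ be an arbitrary graph with clique number $\omega(H)=\omega$. Then $$\mathrm{IR}(G,H)\ \ge\ (\alpha-1)\frac{\omega(\omega-1)}{2}+\omega.$$
   Context: All graphs are finite and simple. A graph $F$ strongly arrows a pair of graphs $(G,H)$, written $F\to(G,H)$, if every colouring of the edges of $F$ with two colours, red and blue, yields either a red copy of $G$ that is an induced subgraph of $F$ or a blue copy of $H$ that is an induced subgraph of $F$. The induced Ramsey number is $\mathrm{IR}(G,H)=\min\{|V(F)| : F\to(G,H)\}$. Here $\alpha(G)$ is the maximum size of a set of pairwise non-adjacent vertices of $G$, and $\omega(H)$ is the maximum size of a clique in $H$. -}

module Defs where

open import Data.Nat using (ℕ; _+_; _*_; _∸_; _≤_)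
open import Data.Nat.DivMod using (_/_)
open import Data.Bool using (Bool; true; false)
open import Data.Fin using (Fin)
open import Data.Fin.Subset using (Subset; _∈_; ∣_∣)
open import Data.Product using (Σ; _×_; ∃)
open import Data.Sum using (_⊎_)
open import Function.Definitions using (Injective)
open import Relation.Binary.PropositionalEquality using (_≡_; _≢_)

record Graph : Set where
  field
    size   : ℕ
    adj    : Fin size → Fin size → Bool
    sym    : ∀ u v → adj u v ≡ adj v u
    irrefl : ∀ u → adj u u ≡ false
open Graph public

∣V∣ : Graph → ℕ
∣V∣ = size

data Reachable (G : Graph) : Fin (size G) → Fin (size G) → Set where
  here : ∀ {u} → Reachable G u u
  step : ∀ {u w v} → adj G u w ≡ true → Reachable G w v → Reachable G u v

Connected : Graph → Set
Connected G = ∀ u v → Reachable G u v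

Independent : (G : Graph) → Subset (size G) → Set
Independent G S = ∀ u v → u ∈ S → v ∈ S → adj G u v ≡ false

Clique : (G : Graph) → Subset (size G) → Set
Clique G S = ∀ u v → u ∈ S → v ∈ S → u ≢ v → adj G u v ≡ true

IndependenceNumber : Graph → ℕ → Set
IndependenceNumber G a =
  (Σ (Subset (size G)) λ S → Independent G S × ∣ S ∣ ≡ a)
  × (∀ S → Independent G S → ∣ S ∣ ≤ a)

CliqueNumber : Graph → ℕ → Set
CliqueNumber G w =
  (Σ (Subset (size G)) λ S → Clique G S × ∣ S ∣ ≡ w)
  × (∀ S → Clique G S → ∣ S ∣ ≤ w)

-- A 2-colouring of the edges of F: a symmetric Boolean function on pairs
-- (true = red, false = blue); its values on non-edges are irrelevant.
record Colouring (F : Graph) : Set where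
  field
    col    : Fin (size F) → Fin (size F) → Bool
    colSym : ∀ u v → col u v ≡ col v u
open Colouring public

record InducedCopy (G F : Graph) : Set where
  field
    emb       : Fin (size G) → Fin (size F)
    emb-inj   : Injective _≡_ _≡_ emb
    emb-adj   : ∀ u v → adj G u v ≡ adj F (emb u) (emb v)
open InducedCopy public

MonoInducedCopy : (G F : Graph) → Colouring F → Bool → Set
MonoInducedCopy G F c b =
  Σ (InducedCopy G F) λ e →
    ∀ u v → adj G u v ≡ true → col c (emb e u) (emb e v) ≡ b

_⟶_,_ : Graph → Graph → Graph → Set
F ⟶ G , H = (c : Colouring F) →
  MonoInducedCopy G F c true ⊎ MonoInducedCopy H F c false

bound : ℕ → ℕ → ℕ
bound α ω = (α ∸ 1) * ((ω * (ω ∸ 1)) / 2) + ω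

-- Write α = β + 1 and peel F greedily: repeatedly remove β successive maximum cliques of what is
-- left; each round of β cliques is a group. Colour an edge red iff its ends lie in the same group.
-- A red induced copy of the connected graph G lies inside one group, so two of α independent
-- vertices of G land in the same peeled clique, contradicting inducedness. Hence F contains a blue
-- induced H, whose ω-clique meets every group at most once. When the group containing its first
-- vertex is peeled, k vertices of the clique remain: the first removed clique has at least k
-- vertices and the other β - 1 at least k - 1 each. Summing over k = ω, ..., 1 gives
-- |V(F)| ≥ β (ω choose 2) + ω.

module Submission where

open import Defs hiding (sym)
open import Data.Nat using (ℕ; zero; suc; _+_; _*_; _∸_; _≤_; _<_; _<?_; z≤n; s≤s)
open import Data.Nat.DivMod using (_/_)
open import Data.Nat.Properties
  using (+-suc; +-assoc; +-identityʳ; *-comm; *-identityʳ; *-zeroʳ; ≤-refl; ≤-trans; +-monoˡ-≤; +-monoʳ-≤; +-mono-≤;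
         ∸-monoʳ-<; ≮⇒≥; ≡ᵇ⇒≡; ≡⇒≡ᵇ; module ≤-Reasoning)
import Data.Nat.Properties as ℕ
open import Data.Nat.Combinatorics using (_C_; nC1≡n; nCk≡nPk/k!; nCk+nC[k+1]≡[n+1]C[k+1])
open import Data.Nat.Induction using (<-wellFounded)
open import Data.Nat.Tactic.RingSolver using (solve-∀)
open import Data.Bool using (true; false; if_then_else_; T)
open import Data.Bool.Properties using () renaming (_≟_ to _≟ᴮ_)
open import Data.Unit using (tt)
open import Data.Fin using (Fin; zero; suc)
open import Data.Fin.Properties using (any?; all?; _≟_; suc-injective; punchIn-injective; punchInᵢ≢i; pigeonhole; injective⇒≤; <⇒≢)
open import Data.Fin.Subset using (Subset; _∈_; _∉_; _⊆_; _─_; _∪_; ⊥; ⊤; ⁅_⁆; ∣_∣; inside; outside; Nonempty)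
open import Data.Fin.Subset.Properties
open import Data.Vec using ([]; _∷_; here; there)
open import Data.Vec.Functional using (removeAt)
open import Data.Product using (Σ; ∃; _×_; _,_; proj₁; proj₂)
open import Data.Sum using (inj₁; inj₂)
open import Function using (_∘_; mk⇔)
open import Function.Definitions using (Injective)
open import Induction.WellFounded using (Acc; acc)
open import Relation.Nullary using (¬_; Dec; yes; no; does; contradiction)
open import Relation.Nullary.Decidable using (_×-dec_; _→-dec_; ¬?; dec-true; dec-false; does-⇔; decidable-stable)
open import Relation.Unary using (Pred; Decidable)
open import Relation.Binary.PropositionalEquality

private variable
  n k : ℕ

q⊆p⇒∣p∣≡∣q∣+∣p─q∣ : ∀ {n} {p q : Subset n} → q ⊆ p → ∣ p ∣ ≡ ∣ q ∣ + ∣ p ─ q ∣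
q⊆p⇒∣p∣≡∣q∣+∣p─q∣ {p = []}          {q = []}          _   = refl
q⊆p⇒∣p∣≡∣q∣+∣p─q∣ {p = inside ∷ p}  {q = outside ∷ q} q⊆p =
  trans (cong suc (q⊆p⇒∣p∣≡∣q∣+∣p─q∣ (drop-∷-⊆ q⊆p))) (sym (+-suc ∣ q ∣ _))
q⊆p⇒∣p∣≡∣q∣+∣p─q∣ {p = outside ∷ p} {q = outside ∷ q} q⊆p = q⊆p⇒∣p∣≡∣q∣+∣p─q∣ (drop-∷-⊆ q⊆p)
q⊆p⇒∣p∣≡∣q∣+∣p─q∣ {p = inside ∷ p}  {q = inside ∷ q}  q⊆p = cong suc (q⊆p⇒∣p∣≡∣q∣+∣p─q∣ (drop-∷-⊆ q⊆p))
q⊆p⇒∣p∣≡∣q∣+∣p─q∣ {p = outside ∷ p} {q = inside ∷ q}  q⊆p with () ← q⊆p here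

x∈p∧x∉p─q⇒x∈q : ∀ {n} {p q : Subset n} {x : Fin n} → x ∈ p → x ∉ p ─ q → x ∈ q
x∈p∧x∉p─q⇒x∈q {q = q} {x = x} x∈p x∉p─q with x ∈? q
... | yes x∈q = x∈q
... | no  x∉q = contradiction (x∈p∧x∉q⇒x∈p─q x∈p x∉q) x∉p─q

element : (p : Subset n) → Fin ∣ p ∣ → Fin n
element (inside  ∷ p) zero    = zero
element (inside  ∷ p) (suc i) = suc (element p i)
element (outside ∷ p) i       = suc (element p i)

element∈p : (p : Subset n) (i : Fin ∣ p ∣) → element p i ∈ p
element∈p (inside  ∷ p) zero    = here
element∈p (inside  ∷ p) (suc i) = there (element∈p p i)
element∈p (outside ∷ p) i       = there (element∈p p i)

element-injective : (p : Subset n) → Injective _≡_ _≡_ (element p)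
element-injective (inside  ∷ p) {zero}  {zero}  _  = refl
element-injective (inside  ∷ p) {suc i} {suc j} eq = cong suc (element-injective p (suc-injective eq))
element-injective (outside ∷ p)                 eq = element-injective p (suc-injective eq)

position : ∀ {x} (p : Subset n) → x ∈ p → Fin ∣ p ∣
position (inside  ∷ p) here      = zero
position (inside  ∷ p) (there m) = suc (position p m)
position (outside ∷ p) (there m) = position p m

position-injective : ∀ {x y} (p : Subset n) (x∈p : x ∈ p) (y∈p : y ∈ p) →
                     position p x∈p ≡ position p y∈p → x ≡ y
position-injective (inside  ∷ p) here       here       _  = refl
position-injective (inside  ∷ p) (there x∈p) (there y∈p) eq =
  cong suc (position-injective p x∈p y∈p (suc-injective eq))
position-injective (outside ∷ p) (there x∈p) (there y∈p) eq =
  cong suc (position-injective p x∈p y∈p eq)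

injective⇒≤∣p∣ : ∀ {k n} {p : Subset n} {f : Fin k → Fin n} → Injective _≡_ _≡_ f → (∀ i → f i ∈ p) → k ≤ ∣ p ∣
injective⇒≤∣p∣ {p = p} f-inj f∈p =
  injective⇒≤ (λ eq → f-inj (position-injective p (f∈p _) (f∈p _) eq))

image : (Fin k → Fin n) → Subset n
image {zero}  f = ⊥
image {suc k} f = ⁅ f zero ⁆ ∪ image (f ∘ suc)

f∈image : (f : Fin k → Fin n) (i : Fin k) → f i ∈ image f
f∈image f zero    = x∈p∪q⁺ (inj₁ (x∈⁅x⁆ (f zero)))
f∈image f (suc i) = x∈p∪q⁺ (inj₂ (f∈image (f ∘ suc) i))

∈image⁻ : (f : Fin k → Fin n) → ∀ {x} → x ∈ image f → ∃ λ i → f i ≡ x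
∈image⁻ {zero}  f x∈ = contradiction x∈ ∉⊥
∈image⁻ {suc k} f x∈ with x∈p∪q⁻ ⁅ f zero ⁆ (image (f ∘ suc)) x∈
... | inj₁ x∈⁅f0⁆ = zero , sym (x∈⁅y⁆⇒x≡y (f zero) x∈⁅f0⁆)
... | inj₂ x∈img  with i , eq ← ∈image⁻ (f ∘ suc) x∈img = suc i , eq

maximumSubset : ∀ {n ℓ} {P : Pred (Subset n) ℓ} → Decidable P → ∀ {q} → P q →
                ∃ λ M → P M × (∀ S → P S → ∣ S ∣ ≤ ∣ M ∣)
maximumSubset {n = n} {P = P} P? {q} Pq = search q Pq (<-wellFounded (n ∸ ∣ q ∣))
  where
  search : ∀ S → P S → Acc _<_ (n ∸ ∣ S ∣) → ∃ λ M → P M × (∀ S → P S → ∣ S ∣ ≤ ∣ M ∣)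
  search S PS (acc rs) with anySubset? (λ T → P? T ×-dec ∣ S ∣ <? ∣ T ∣)
  ... | yes (T , PT , S<T) = search T PT (rs (∸-monoʳ-< S<T (∣p∣≤n T)))
  ... | no ¬larger = S , PS , λ T PT → ≮⇒≥ (λ S<T → ¬larger (T , PT , S<T))

k*[k∸1]/2≡kC2 : ∀ k → k * (k ∸ 1) / 2 ≡ k C 2
k*[k∸1]/2≡kC2 zero              = refl
k*[k∸1]/2≡kC2 (suc zero)        = refl
k*[k∸1]/2≡kC2 k@(suc (suc k-2)) = begin
  k * suc k-2 / 2          ≡⟨ cong (_/ 2) (*-comm k (suc k-2)) ⟩
  suc k-2 * k / 2          ≡⟨ cong (λ x → suc k-2 * x / 2) (*-identityʳ k) ⟨
  suc k-2 * (k * 1) / 2    ≡⟨ nCk≡nPk/k! {n = k} (s≤s (s≤s z≤n)) ⟨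
  k C 2                    ∎
  where open ≡-Reasoning

[1+k]C2≡k+kC2 : ∀ k → suc k C 2 ≡ k + k C 2
[1+k]C2≡k+kC2 k = trans (sym (nCk+nC[k+1]≡[n+1]C[k+1] k 1)) (cong (_+ k C 2) (nC1≡n k))

ramseyBound : ℕ → ℕ → ℕ
ramseyBound β k = β * (k C 2) + k

bound≡ramseyBound : ∀ β k → bound (suc β) k ≡ ramseyBound β k
bound≡ramseyBound β k = cong (λ c → β * c + k) (k*[k∸1]/2≡kC2 k)

ramseyBound-zero : ∀ β → ramseyBound β 0 ≡ 0
ramseyBound-zero β = trans (+-identityʳ (β * 0)) (*-zeroʳ β)

ramseyBound-suc : ∀ j k → ramseyBound (suc j) (suc k) ≡ suc k + j * k + ramseyBound (suc j) k
ramseyBound-suc j k rewrite [1+k]C2≡k+kC2 k = identity j k (k C 2)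
  where
  identity : ∀ j k c → suc j * (k + c) + suc k ≡ suc k + j * k + (suc j * c + k)
  identity = solve-∀

piecewise : ∀ {A : Set} → Subset n → (Fin n → A) → (Fin n → A) → Fin n → A
piecewise p f g x = if does (x ∈? p) then f x else g x

piecewise-∈ : ∀ {A : Set} {p : Subset n} {f g : Fin n → A} {x} → x ∈ p → piecewise p f g x ≡ f x
piecewise-∈ {p = p} {x = x} x∈p rewrite dec-true (x ∈? p) x∈p = refl

piecewise-∉ : ∀ {A : Set} {p : Subset n} {f g : Fin n → A} {x} → x ∉ p → piecewise p f g x ≡ g x
piecewise-∉ {p = p} {x = x} x∉p rewrite dec-false (x ∈? p) x∉p = refl

record KClique (F : Graph) (k : ℕ) : Set where
  field
    vertex   : Fin k → Fin (size F)
    adjacent : ∀ i j → i ≢ j → adj F (vertex i) (vertex j) ≡ true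
open KClique public

module _ (F : Graph) where

  private
    V : Set
    V = Fin (size F)

  _within_ : KClique F k → Subset (size F) → Set
  K within R = ∀ i → vertex K i ∈ R

  Rainbow : (V → ℕ) → KClique F k → Set
  Rainbow c K = ∀ i j → i ≢ j → c (vertex K i) ≢ c (vertex K j)

  emptyClique : KClique F 0
  emptyClique = record { vertex = λ () ; adjacent = λ () }

  singletonClique : V → KClique F 1
  singletonClique x = record { vertex = λ _ → x ; adjacent = λ { zero zero 0≢0 → contradiction refl 0≢0 } }

  removeVertex : KClique F (suc k) → Fin (suc k) → KClique F k
  removeVertex K i = record
    { vertex   = removeAt (vertex K) i
    ; adjacent = λ j l j≢l → adjacent K _ _ (j≢l ∘ punchIn-injective i j l)
    }

  vertex-injective : (K : KClique F k) → Injective _≡_ _≡_ (vertex K)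
  vertex-injective K {i} {j} eq with i ≟ j
  ... | yes i≡j = i≡j
  ... | no  i≢j = contradiction
    (trans (sym (irrefl F (vertex K j))) (subst (λ x → adj F x (vertex K j) ≡ true) eq (adjacent K i j i≢j)))
    λ ()

  clique? : (S : Subset (size F)) → Dec (Clique F S)
  clique? S = all? λ u → all? λ v →
    (u ∈? S) →-dec (v ∈? S) →-dec ¬? (u ≟ v) →-dec (adj F u v ≟ᴮ true)

  image-clique : (K : KClique F k) → Clique F (image (vertex K))
  image-clique K u v u∈ v∈ u≢v with ∈image⁻ (vertex K) u∈ | ∈image⁻ (vertex K) v∈
  ... | i , refl | j , refl = adjacent K i j (u≢v ∘ cong (vertex K))

  image-⊆ : ∀ {R} (K : KClique F k) → K within R → image (vertex K) ⊆ R
  image-⊆ K K⊆R x∈ with i , refl ← ∈image⁻ (vertex K) x∈ = K⊆R i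

  record MaximumClique (R : Subset (size F)) : Set where
    field
      Q        : Subset (size F)
      Q⊆R      : Q ⊆ R
      Q-clique : Clique F Q
      maximum  : (K : KClique F k) → K within R → k ≤ ∣ Q ∣

  maximumClique : ∀ R → MaximumClique R
  maximumClique R
    with Q , (Q⊆R , Q-clique) , largest ←
         maximumSubset (λ S → (S ⊆? R) ×-dec clique? S) {⊥} (⊆-min R , λ u _ u∈⊥ → contradiction u∈⊥ ∉⊥)
    = record
    { Q = Q ; Q⊆R = Q⊆R ; Q-clique = Q-clique
    ; maximum = λ K K⊆R → ≤-trans (injective⇒≤∣p∣ (vertex-injective K) (f∈image (vertex K)))
                                  (largest _ (image-⊆ K K⊆R , image-clique K))
    }

  record Layer (j : ℕ) (R : Subset (size F)) : Set where
    field
      rest         : Subset (size F)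
      rest⊆R       : rest ⊆ R
      class        : V → Fin (suc j)
      class-clique : ∀ {u v} → u ∈ R → v ∈ R → u ∉ rest → v ∉ rest →
                     class u ≡ class v → u ≢ v → adj F u v ≡ true
      large        : ∀ {k m} (K : KClique F k) (K′ : KClique F m) → K within R → K′ within rest →
                     k + j * m + ∣ rest ∣ ≤ ∣ R ∣

  -- Peel j + 1 successive maximum cliques off R. The first is maximum in R ⊇ K, each later
  -- one is maximum in a set containing rest ⊇ K′; this gives the bound in `large`.
  layer : ∀ j R → Layer j R
  layer zero R = record
    { rest         = R ─ Q
    ; rest⊆R       = p─q⊆p R Q
    ; class        = λ _ → zero
    ; class-clique = λ u∈R v∈R u∉rest v∉rest _ →
                       Q-clique _ _ (x∈p∧x∉p─q⇒x∈q u∈R u∉rest) (x∈p∧x∉p─q⇒x∈q v∈R v∉rest)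
    ; large        = λ {k} K _ K⊆R _ → begin
        k + 0 + ∣ R ─ Q ∣     ≡⟨ cong (_+ ∣ R ─ Q ∣) (+-identityʳ k) ⟩
        k + ∣ R ─ Q ∣         ≤⟨ +-monoˡ-≤ ∣ R ─ Q ∣ (maximum K K⊆R) ⟩
        ∣ Q ∣ + ∣ R ─ Q ∣     ≡⟨ q⊆p⇒∣p∣≡∣q∣+∣p─q∣ Q⊆R ⟨
        ∣ R ∣                 ∎
    }
    where
    open MaximumClique (maximumClique R)
    open ≤-Reasoning
  layer (suc j) R = record
    { rest         = Λ.rest
    ; rest⊆R       = p─q⊆p R Q ∘ Λ.rest⊆R
    ; class        = class
    ; class-clique = class-clique
    ; large        = large
    }
    where
    open MaximumClique (maximumClique R)
    module Λ = Layer (layer j (R ─ Q))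

    class : V → Fin (suc (suc j))
    class = piecewise Q (λ _ → zero) (suc ∘ Λ.class)

    class-clique : ∀ {u v} → u ∈ R → v ∈ R → u ∉ Λ.rest → v ∉ Λ.rest →
                   class u ≡ class v → u ≢ v → adj F u v ≡ true
    -- Abstracting u ∈? Q and v ∈? Q also evaluates both sides of `same`.
    class-clique {u} {v} u∈R v∈R u∉rest v∉rest same u≢v with u ∈? Q | v ∈? Q
    ... | yes u∈Q | yes v∈Q = Q-clique u v u∈Q v∈Q u≢v
    ... | yes u∈Q | no  v∉Q = contradiction same λ ()
    ... | no  u∉Q | yes v∈Q = contradiction same λ ()
    ... | no  u∉Q | no  v∉Q =
      Λ.class-clique (x∈p∧x∉q⇒x∈p─q u∈R u∉Q) (x∈p∧x∉q⇒x∈p─q v∈R v∉Q) u∉rest v∉rest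
        (suc-injective same) u≢v

    large : ∀ {k m} (K : KClique F k) (K′ : KClique F m) → K within R → K′ within Λ.rest →
            k + suc j * m + ∣ Λ.rest ∣ ≤ ∣ R ∣
    large {k} {m} K K′ K⊆R K′⊆rest = begin
      k + suc j * m + ∣ Λ.rest ∣      ≡⟨ +-assoc k (suc j * m) ∣ Λ.rest ∣ ⟩
      k + (m + j * m + ∣ Λ.rest ∣)    ≤⟨ +-mono-≤ (maximum K K⊆R) (Λ.large K′ K′ (Λ.rest⊆R ∘ K′⊆rest) K′⊆rest) ⟩
      ∣ Q ∣ + ∣ R ─ Q ∣               ≡⟨ q⊆p⇒∣p∣≡∣q∣+∣p─q∣ Q⊆R ⟨
      ∣ R ∣                           ∎
      where open ≤-Reasoning

  ∃-removeVertex-within : ∀ {R} {c : V → ℕ} (K : KClique F (suc k)) → Rainbow c K →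
                          (∀ {u v} → u ∉ R → v ∉ R → c u ≡ c v) →
                          ∃ λ i → removeVertex K i within R
  ∃-removeVertex-within {R = R} K rainbow c-const-outside with any? (λ i → ¬? (vertex K i ∈? R))
  ... | yes (i , i∉R) = i , λ l → decidable-stable (_ ∈? R) λ l∉R →
                          rainbow _ _ (punchInᵢ≢i i l) (c-const-outside l∉R i∉R)
  ... | no  ¬∃i∉R     = zero , λ l → decidable-stable (_ ∈? R) λ l∉R → ¬∃i∉R (_ , l∉R)

  record Decomposition (j : ℕ) (R : Subset (size F)) : Set where
    field
      group        : V → ℕ
      class        : V → Fin (suc j)
      class-clique : ∀ {u v} → u ∈ R → v ∈ R → group u ≡ group v → class u ≡ class v →
                     u ≢ v → adj F u v ≡ true
      large        : ∀ {k} (K : KClique F k) → K within R → Rainbow group K →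
                     ramseyBound (suc j) k ≤ ∣ R ∣

  emptyDecomposition : ∀ {j R} → ¬ Nonempty R → Decomposition j R
  emptyDecomposition {j} {R} R-empty = record
    { group        = λ _ → 0
    ; class        = λ _ → zero
    ; class-clique = λ u∈R _ _ _ _ → contradiction (_ , u∈R) R-empty
    ; large        = large
    }
    where
    large : ∀ {k} (K : KClique F k) → K within R → Rainbow (λ _ → 0) K → ramseyBound (suc j) k ≤ ∣ R ∣
    large {zero}  _ _   _ = subst (_≤ ∣ R ∣) (sym (ramseyBound-zero (suc j))) z≤n
    large {suc k} K K⊆R _ = contradiction (_ , K⊆R zero) R-empty

  decompose : ∀ j R → Acc _<_ ∣ R ∣ → Decomposition j R
  decompose j R (acc rec) with nonempty? R
  ... | no  R-empty   = emptyDecomposition R-empty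
  ... | yes (x , x∈R) = record
    { group        = group
    ; class        = class
    ; class-clique = class-clique
    ; large        = large
    }
    where
    module Λ = Layer (layer j R)

    ∣rest∣<∣R∣ : ∣ Λ.rest ∣ < ∣ R ∣
    ∣rest∣<∣R∣ = subst (λ z → suc (z + ∣ Λ.rest ∣) ≤ ∣ R ∣) (*-zeroʳ j)
                   (Λ.large (singletonClique x) emptyClique (λ _ → x∈R) (λ ()))

    module D = Decomposition (decompose j Λ.rest (rec ∣rest∣<∣R∣))

    group : V → ℕ
    group = piecewise Λ.rest (suc ∘ D.group) (λ _ → 0)

    group-∈ : ∀ {u} → u ∈ Λ.rest → group u ≡ suc (D.group u)
    group-∈ = piecewise-∈ {f = suc ∘ D.group}

    group-∉ : ∀ {u} → u ∉ Λ.rest → group u ≡ 0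
    group-∉ = piecewise-∉ {f = suc ∘ D.group}

    class : V → Fin (suc j)
    class = piecewise Λ.rest D.class Λ.class

    class-clique : ∀ {u v} → u ∈ R → v ∈ R → group u ≡ group v →
                   class u ≡ class v → u ≢ v → adj F u v ≡ true
    class-clique {u} {v} u∈R v∈R same-group same-class u≢v with u ∈? Λ.rest | v ∈? Λ.rest
    ... | yes u∈rest | yes v∈rest = D.class-clique u∈rest v∈rest (ℕ.suc-injective same-group) same-class u≢v
    ... | yes _      | no  _      = contradiction same-group λ ()
    ... | no  _      | yes _      = contradiction same-group λ ()
    ... | no  u∉rest | no  v∉rest = Λ.class-clique u∈R v∈R u∉rest v∉rest same-class u≢v

    large : ∀ {k} (K : KClique F k) → K within R → Rainbow group K → ramseyBound (suc j) k ≤ ∣ R ∣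
    large {zero}  _ _ _ = subst (_≤ ∣ R ∣) (sym (ramseyBound-zero (suc j))) z≤n
    -- A rainbow clique meets the first layer at most once, so all but one of its vertices lie in rest.
    large {suc k} K K⊆R rainbow
      with i , K′⊆rest ← ∃-removeVertex-within K rainbow (λ u∉ v∉ → trans (group-∉ u∉) (sym (group-∉ v∉)))
      = begin
        ramseyBound (suc j) (suc k)                     ≡⟨ ramseyBound-suc j k ⟩
        suc k + j * k + ramseyBound (suc j) k           ≤⟨ +-monoʳ-≤ (suc k + j * k) (D.large K′ K′⊆rest rainbow′) ⟩
        suc k + j * k + ∣ Λ.rest ∣                      ≤⟨ Λ.large K K′ K⊆R K′⊆rest ⟩
        ∣ R ∣                                           ∎
      where
      open ≤-Reasoning
      K′ = removeVertex K i
      rainbow′ : Rainbow D.group K′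
      rainbow′ l l′ l≢l′ same = rainbow _ _ (l≢l′ ∘ punchIn-injective i l l′)
        (trans (group-∈ (K′⊆rest l)) (trans (cong suc same) (sym (group-∈ (K′⊆rest l′)))))

  subsetClique : ∀ {S k} → Clique F S → ∣ S ∣ ≡ k → KClique F k
  subsetClique {S} S-clique refl = record
    { vertex   = element S
    ; adjacent = λ i l i≢l → S-clique _ _ (element∈p S i) (element∈p S l) (i≢l ∘ element-injective S)
    }

  sameGroupColouring : (V → ℕ) → Colouring F
  sameGroupColouring group = record
    { col    = λ u v → does (group u ℕ.≟ group v)
    ; colSym = λ u v → does-⇔ (mk⇔ sym sym) (group u ℕ.≟ group v) (group v ℕ.≟ group u)
    }

  inducedClique : ∀ {H k} → InducedCopy H F → KClique H k → KClique F k
  inducedClique e K = record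
    { vertex   = emb e ∘ vertex K
    ; adjacent = λ i l i≢l → trans (sym (emb-adj e _ _)) (adjacent K i l i≢l)
    }

  module _ (group : V → ℕ) where

    red⇒same-group : ∀ {u v} → col (sameGroupColouring group) u v ≡ true → group u ≡ group v
    red⇒same-group red = ≡ᵇ⇒≡ _ _ (subst T (sym red) tt)

    blue⇒different-group : ∀ {u v} → col (sameGroupColouring group) u v ≡ false → group u ≢ group v
    blue⇒different-group blue same = subst T blue (≡⇒≡ᵇ _ _ same)

    blue-copy⇒rainbow-clique : ∀ {H k} → KClique H k → MonoInducedCopy H F (sameGroupColouring group) false →
                               Σ (KClique F k) (Rainbow group)
    blue-copy⇒rainbow-clique K (e , blue) =
      inducedClique e K , λ i l i≢l → blue⇒different-group (blue _ _ (adjacent K i l i≢l))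

    no-red-copy : ∀ {j} (class : V → Fin (suc j)) →
                  (∀ {u v} → group u ≡ group v → class u ≡ class v → u ≢ v → adj F u v ≡ true) →
                  ∀ G → Connected G → ∀ S → Independent G S → ∣ S ∣ ≡ suc (suc j) →
                  ¬ MonoInducedCopy G F (sameGroupColouring group) true
    no-red-copy {j} class class-clique G connected S S-independent ∣S∣≡2+j (e , red)
      with i , l , i<l , same-class ← pigeonhole (subst (suc j <_) (sym ∣S∣≡2+j) ≤-refl) (class ∘ emb e ∘ element S)
      = contradiction (begin
          false                                             ≡⟨ S-independent _ _ (element∈p S i) (element∈p S l) ⟨
          adj G (element S i) (element S l)                 ≡⟨ emb-adj e _ _ ⟩
          adj F (emb e (element S i)) (emb e (element S l)) ≡⟨ class-clique (same-group (connected _ _)) same-class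
                                                                (<⇒≢ i<l ∘ element-injective S ∘ emb-inj e) ⟩
          true                                              ∎) λ ()
      where
      open ≡-Reasoning
      same-group : ∀ {u v} → Reachable G u v → group (emb e u) ≡ group (emb e v)
      same-group here          = refl
      same-group (step uw w⇝v) = trans (red⇒same-group (red _ _ uw)) (same-group w⇝v)

theorem1 : (G H : Graph) (α ω : ℕ) →
    Connected G → IndependenceNumber G α → 2 ≤ α →
    CliqueNumber H ω →
    (F : Graph) → F ⟶ G , H → bound α ω ≤ ∣V∣ F
theorem1 G H .(suc (suc j)) ω connected ((S , S-independent , ∣S∣≡α) , _) (s≤s (s≤s {n = j} z≤n))
         ((T , T-clique , ∣T∣≡ω) , _) F F⟶G,H = begin
  bound (suc (suc j)) ω    ≡⟨ bound≡ramseyBound (suc j) ω ⟩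
  ramseyBound (suc j) ω    ≤⟨ D.large (proj₁ rainbowClique) (λ _ → ∈⊤) (proj₂ rainbowClique) ⟩
  ∣ ⊤ {size F} ∣           ≡⟨ ∣⊤∣≡n (size F) ⟩
  size F                   ∎
  where
  open ≤-Reasoning
  module D = Decomposition (decompose F j ⊤ (<-wellFounded _))

  rainbowClique : Σ (KClique F ω) (Rainbow F D.group)
  rainbowClique with F⟶G,H (sameGroupColouring F D.group)
  ... | inj₁ red  = contradiction red
                      (no-red-copy F D.group D.class (D.class-clique ∈⊤ ∈⊤) G connected S S-independent ∣S∣≡α)
  ... | inj₂ blue = blue-copy⇒rainbow-clique F D.group (subsetClique H T-clique ∣T∣≡ω) blue
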